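{- Let $f:W_{\mathrm{af}}\to S$ be a function, extended $\mathbb{Z}$-linearly to the group ring $\mathbb{Z}[W_{\mathrm{af}}]$, such that $f\big((1-t_{\alpha^\vee})^dw\big)\in\alpha^dS$ for all integers $d\ge1$, all $w\in W_{\mathrm{af}}$ and all $\alpha\in\Phi$. Then for all $d\in\mathbb{Z}_{>0}$, $p\in\mathbb{Z}$, $\alpha\in\Phi$ and $w\in W_{\mathrm{af}}$, $$f\big((1-t_{\alpha^\vee})^{d-1}w\big)\equiv f\big((1-t_{\alpha^\vee})^{d-1}t_{p\alpha^\vee}w\big)\mod \alpha^dS.$$
   Context: Fix an irreducible finite root datum with weight lattice $X$, root system $\Phi\subset X$, coroots $\alpha^\vee$, coroot lattice $Q^\vee$ and finite Weyl group $W$. Let $S=\mathrm{Sym}(X)$. The affine Weyl group is $W_{\mathrm{af}}=W\ltimes Q^\vee$, where $t_\mu$ ($\mu\in Q^\vee$) denotes translation, $t_\lambda t_\mu=t_{\lambda+\mu}$ and $wt_\mu w^{ -1}=t_{w\mu}$ for $w\in W$. -}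

module Defs where

open import Data.Nat as ℕ using (ℕ; zero; suc)
open import Data.Integer as ℤ using (ℤ; +_; 0ℤ; 1ℤ)
open import Data.Fin using (Fin; _≟_)
open import Data.Bool using (Bool)
open import Relation.Nullary using (yes; no)
open import Data.Vec as Vec using (Vec; []; _∷_; zipWith; replicate; tabulate; lookup; foldr)
open import Data.List as List using (List; []; _∷_; _++_; concatMap; map)
open import Data.List.Membership.Propositional using (_∈_)
open import Data.List.Relation.Unary.Unique.Propositional using (Unique)
open import Data.Product using (Σ; _×_; _,_; proj₁; proj₂; ∃)
open import Relation.Binary.PropositionalEquality using (_≡_; _≢_)

-- Weight lattice X = ℤⁿ (a chosen basis), coweight lattice X^∨ = ℤⁿ,
-- perfect pairing = dot product.

Lat : ℕ → Set
Lat n = Vec ℤ n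

⟨_,_⟩ : ∀ {n} → Lat n → Lat n → ℤ
⟨ x , y ⟩ = foldr (λ _ → ℤ) ℤ._+_ 0ℤ (zipWith ℤ._*_ x y)

_⊕_ : ∀ {n} → Lat n → Lat n → Lat n
_⊕_ = zipWith ℤ._+_

_·_ : ∀ {n} → ℤ → Lat n → Lat n
c · x = Vec.map (c ℤ.*_) x

_⊖_ : ∀ {n} → Lat n → Lat n → Lat n
x ⊖ y = x ⊕ ((ℤ.- 1ℤ) · y)

zeroL : ∀ {n} → Lat n
zeroL = replicate _ 0ℤ

sRef : ∀ {n} → Lat n → Lat n → Lat n → Lat n
sRef a a∨ x = x ⊖ (⟨ x , a∨ ⟩ · a)

sCoref : ∀ {n} → Lat n → Lat n → Lat n → Lat n
sCoref a a∨ y = y ⊖ (⟨ a , y ⟩ · a∨)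

record RootDatum (n : ℕ) : Set where
  field
    Φ              : List (Lat n × Lat n)
    unique-roots   : Unique (map proj₁ Φ)
    unique-coroots : Unique (map proj₂ Φ)
    pair-two       : ∀ {a a∨} → (a , a∨) ∈ Φ → ⟨ a , a∨ ⟩ ≡ + 2
    refl-closed    : ∀ {a a∨ b b∨} → (a , a∨) ∈ Φ → (b , b∨) ∈ Φ →
                     (sRef a a∨ b , sCoref a a∨ b∨) ∈ Φ
    -- irreducibility: Φ nonempty and not a union of two nonempty
    -- mutually orthogonal parts
    nonempty       : Φ ≢ []
    irreducible    : (c : Lat n × Lat n → Bool) →
                     (∀ {a a∨ b b∨} → (a , a∨) ∈ Φ → (b , b∨) ∈ Φ →
                        c (a , a∨) ≢ c (b , b∨) → ⟨ a , b∨ ⟩ ≡ 0ℤ) →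
                     ∀ {a a∨ b b∨} → (a , a∨) ∈ Φ → (b , b∨) ∈ Φ →
                        c (a , a∨) ≡ c (b , b∨)
open RootDatum public

-- Finite Weyl group W, represented faithfully by its action on X^∨ = ℤⁿ
-- as integer matrices (list of rows), and the coroot lattice Q^∨.

Mat : ℕ → Set
Mat n = Vec (Vec ℤ n) n

_⋆_ : ∀ {n} → Mat n → Lat n → Lat n
M ⋆ y = Vec.map (λ row → ⟨ row , y ⟩) M

col : ∀ {n} → Mat n → Fin n → Lat n
col N j = Vec.map (λ r → lookup r j) N

_∘M_ : ∀ {n} → Mat n → Mat n → Mat n
M ∘M N = Vec.map (λ row → tabulate (λ j → ⟨ row , col N j ⟩)) M

δ : ∀ {n} → Fin n → Fin n → ℤ
δ i j with i ≟ j
... | yes _ = 1ℤ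
... | no _ = 0ℤ

idM : ∀ {n} → Mat n
idM = tabulate (λ i → tabulate (λ j → δ i j))

-- matrix of s_α acting on X^∨ (y ↦ y - ⟨α,y⟩α^∨): entries δᵢⱼ - α^∨ᵢ αⱼ
reflM : ∀ {n} → Lat n → Lat n → Mat n
reflM a a∨ = tabulate (λ i → tabulate (λ j → δ i j ℤ.- lookup a∨ i ℤ.* lookup a j))

-- W = subgroup of GL(X^∨) generated by the reflections s_α (α ∈ Φ)
-- (generators are involutions, so the monoid they generate is the group)
data InW {n} (R : RootDatum n) : Mat n → Set where
  w-id   : InW R idM
  w-refl : ∀ {a a∨ M} → (a , a∨) ∈ Φ R → InW R M → InW R (reflM a a∨ ∘M M)

data InQ∨ {n} (R : RootDatum n) : Lat n → Set where
  q-zero  : InQ∨ R zeroL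
  q-plus  : ∀ {a a∨ μ} → (a , a∨) ∈ Φ R → InQ∨ R μ → InQ∨ R (μ ⊕ a∨)
  q-minus : ∀ {a a∨ μ} → (a , a∨) ∈ Φ R → InQ∨ R μ → InQ∨ R (μ ⊖ a∨)

-- Affine Weyl group W_af = W ⋉ Q^∨.  The pair (μ , M) stands for t_μ w
-- where w ∈ W acts on X^∨ by M.  Product: t_λ u · t_μ v = t_{λ + uμ} uv.

Aff : ℕ → Set
Aff n = Lat n × Mat n

InWaf : ∀ {n} → RootDatum n → Aff n → Set
InWaf R (μ , M) = InQ∨ R μ × InW R M

_∙_ : ∀ {n} → Aff n → Aff n → Aff n
(λ' , u) ∙ (μ , v) = (λ' ⊕ (u ⋆ μ) , u ∘M v)

t : ∀ {n} → Lat n → Aff n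
t μ = (μ , idM)

-- Group ring ℤ[W_af] as formal finite ℤ-linear combinations.

ZAff : ℕ → Set
ZAff n = List (ℤ × Aff n)

[_] : ∀ {n} → Aff n → ZAff n
[ g ] = (1ℤ , g) ∷ []

oneZ : ∀ {n} → ZAff n
oneZ = [ t zeroL ]

_-Z_ : ∀ {n} → ZAff n → ZAff n → ZAff n
xs -Z ys = xs ++ map (λ { (c , g) → (ℤ.- c , g) }) ys

_*Z_ : ∀ {n} → ZAff n → ZAff n → ZAff n
xs *Z ys = concatMap (λ { (c , g) → map (λ { (e , h) → (c ℤ.* e , g ∙ h) }) ys }) xs

_^Z_ : ∀ {n} → ZAff n → ℕ → ZAff n
x ^Z zero = oneZ
x ^Z suc k = x *Z (x ^Z k)

-- S = Sym(X) = ℤ[x₁,…,xₙ]: polynomial expressions, equality = equality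
-- of polynomial functions on ℤⁿ (faithful since ℤ is an infinite domain).

data Poly (n : ℕ) : Set where
  con  : ℤ → Poly n
  var  : Fin n → Poly n
  _⊞_  : Poly n → Poly n → Poly n
  _⊠_  : Poly n → Poly n → Poly n
  ⊟_   : Poly n → Poly n

eval : ∀ {n} → Poly n → Vec ℤ n → ℤ
eval (con c) v = c
eval (var i) v = lookup v i
eval (p ⊞ q) v = eval p v ℤ.+ eval q v
eval (p ⊠ q) v = eval p v ℤ.* eval q v
eval (⊟ p) v = ℤ.- eval p v

_≈P_ : ∀ {n} → Poly n → Poly n → Set
p ≈P q = ∀ v → eval p v ≡ eval q v

_^P_ : ∀ {n} → Poly n → ℕ → Poly n
p ^P zero = con 1ℤ
p ^P suc k = p ⊠ (p ^P k)

_∣P_ : ∀ {n} → Poly n → Poly n → Set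
a ∣P g = ∃ λ h → g ≈P (a ⊠ h)

lin : ∀ {n} → Lat n → Poly n
lin a = foldr (λ _ → Poly _) _⊞_ (con 0ℤ) (tabulate (λ i → con (lookup a i) ⊠ var i))

linExt : ∀ {n} → (Aff n → Poly n) → ZAff n → Poly n
linExt f [] = con 0ℤ
linExt f ((c , g) ∷ xs) = (con c ⊠ f g) ⊞ linExt f xs

-- The powers of 1 - t_{α∨} are combinations of translations, which commute with t_{α∨}, so
-- f((1 - t_{α∨})^d w) = f((1 - t_{α∨})^{d-1} w) - f((1 - t_{α∨})^{d-1} t_{α∨} w).
-- The hypothesis therefore makes g(q) := f((1 - t_{α∨})^{d-1} t_{qα∨} w) constant modulo α^d
-- between consecutive q (every t_{qα∨} w lies in W_af again), and telescoping from q = 0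
-- to q = p gives the claim.
module Submission where

open import Defs
open import Data.Nat using (ℕ; _≤_; _∸_; zero; suc; s≤s; z≤n)
open import Data.Integer as Z using (ℤ; +_; -[1+_]; 0ℤ; 1ℤ)
open import Data.Integer.Tactic.RingSolver using (solve-∀)
open import Data.Fin as F using (Fin)
import Data.Fin.Properties as FP
open import Data.Vec using ([]; _∷_; tabulate; lookup)
import Data.Vec.Properties as VP
import Data.Integer.Properties as ZP
open import Data.List using ([]; _∷_; _++_)
import Data.List.Properties as LP
open import Data.List.Relation.Unary.All as All using (All; []; _∷_)
import Data.List.Relation.Unary.All.Properties as AllP
open import Data.List.Membership.Propositional using (_∈_)
open import Data.Product using (_×_; _,_; proj₂)
open import Function using (_∘_)
open import Relation.Binary.PropositionalEquality hiding ([_])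
open import Relation.Nullary using (Dec; yes; no; contradiction)

private
  variable
    n : ℕ

δ-diag : (i : Fin n) → δ i i ≡ 1ℤ
δ-diag i with i F.≟ i
... | yes _ = refl
... | no i≢i = contradiction refl i≢i

δ-offDiag : {i j : Fin n} → i ≢ j → δ i j ≡ 0ℤ
δ-offDiag {i = i} {j} i≢j with i F.≟ j
... | yes i≡j = contradiction i≡j i≢j
... | no _ = refl

δ-suc : (i j : Fin n) → δ (F.suc i) (F.suc j) ≡ δ i j
δ-suc i j = by-cases (i F.≟ j)
  where
  by-cases : Dec (i ≡ j) → δ (F.suc i) (F.suc j) ≡ δ i j
  by-cases (yes refl) = trans (δ-diag (F.suc i)) (sym (δ-diag i))
  by-cases (no i≢j) = trans (δ-offDiag (i≢j ∘ FP.suc-injective)) (sym (δ-offDiag i≢j))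

⟨⟩-zeroˡ : (g : Fin n → ℤ) → (∀ j → g j ≡ 0ℤ) → (μ : Lat n) → ⟨ tabulate g , μ ⟩ ≡ 0ℤ
⟨⟩-zeroˡ g g≡0 [] = refl
⟨⟩-zeroˡ g g≡0 (y ∷ ys)
  rewrite g≡0 F.zero | ⟨⟩-zeroˡ (g ∘ F.suc) (g≡0 ∘ F.suc) ys = refl

⟨δ,⟩≡lookup : (i : Fin n) (μ : Lat n) → ⟨ tabulate (δ i) , μ ⟩ ≡ lookup μ i
⟨δ,⟩≡lookup {n = suc m} F.zero (y ∷ ys)
  rewrite δ-diag {n = suc m} F.zero
        | ⟨⟩-zeroˡ (δ F.zero ∘ F.suc) (λ j → δ-offDiag {i = F.zero} {F.suc j} (λ ())) ys
  = trans (ZP.+-identityʳ (1ℤ Z.* y)) (ZP.*-identityˡ y)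
⟨δ,⟩≡lookup (F.suc i) (y ∷ ys)
  rewrite δ-offDiag {i = F.suc i} {F.zero} (λ ())
        | VP.tabulate-cong (δ-suc i)
        | ⟨δ,⟩≡lookup i ys
  = ZP.+-identityˡ (lookup ys i)

idM-⋆ : (μ : Lat n) → idM ⋆ μ ≡ μ
idM-⋆ μ = begin
  idM ⋆ μ                           ≡⟨ VP.tabulate-∘ _ _ ⟨
  tabulate (λ i → ⟨ tabulate (δ i) , μ ⟩) ≡⟨ VP.tabulate-cong (λ i → ⟨δ,⟩≡lookup i μ) ⟩
  tabulate (lookup μ)               ≡⟨ VP.tabulate∘lookup μ ⟩
  μ                                 ∎
  where open ≡-Reasoning

idM-∘M : (M : Mat n) → idM ∘M M ≡ M
idM-∘M M = begin
  idM ∘M M                                           ≡⟨ VP.tabulate-∘ _ _ ⟨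
  tabulate (λ i → tabulate (λ j → ⟨ tabulate (δ i) , col M j ⟩))
    ≡⟨ VP.tabulate-cong (λ i → VP.tabulate-cong (λ j → ⟨δ,⟩≡lookup i (col M j))) ⟩
  tabulate (λ i → tabulate (λ j → lookup (col M j) i))
    ≡⟨ VP.tabulate-cong (λ i → VP.tabulate-cong (λ j → VP.lookup-map i (λ r → lookup r j) M)) ⟩
  tabulate (λ i → tabulate (lookup (lookup M i)))
    ≡⟨ VP.tabulate-cong (λ i → VP.tabulate∘lookup (lookup M i)) ⟩
  tabulate (lookup M)                                ≡⟨ VP.tabulate∘lookup M ⟩
  M                                                  ∎
  where open ≡-Reasoning

⊕-identityˡ : (x : Lat n) → zeroL ⊕ x ≡ x
⊕-identityˡ [] = refl
⊕-identityˡ (x ∷ xs) = cong₂ _∷_ (ZP.+-identityˡ x) (⊕-identityˡ xs)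

·-zeroˡ : (x : Lat n) → 0ℤ · x ≡ zeroL
·-zeroˡ [] = refl
·-zeroˡ (x ∷ xs) = cong (0ℤ ∷_) (·-zeroˡ xs)

⊕-assoc-comm : (x y z : Lat n) → (x ⊕ y) ⊕ z ≡ y ⊕ (x ⊕ z)
⊕-assoc-comm [] [] [] = refl
⊕-assoc-comm (x ∷ xs) (y ∷ ys) (z ∷ zs) = cong₂ _∷_ (identity x y z) (⊕-assoc-comm xs ys zs)
  where
  identity : ∀ a b c → (a Z.+ b) Z.+ c ≡ b Z.+ (a Z.+ c)
  identity = solve-∀

⊕-·-suc : (q : ℤ) (x μ : Lat n) → x ⊕ ((q · x) ⊕ μ) ≡ (Z.suc q · x) ⊕ μ
⊕-·-suc q [] [] = refl
⊕-·-suc q (x ∷ xs) (m ∷ ms) = cong₂ _∷_ (identity q x m) (⊕-·-suc q xs ms)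
  where
  identity : ∀ q a b → a Z.+ (q Z.* a Z.+ b) ≡ (1ℤ Z.+ q) Z.* a Z.+ b
  identity = solve-∀

·-suc-⊕ : (q : ℤ) (x μ : Lat n) → ((q · x) ⊕ μ) ⊕ x ≡ (Z.suc q · x) ⊕ μ
·-suc-⊕ q [] [] = refl
·-suc-⊕ q (x ∷ xs) (m ∷ ms) = cong₂ _∷_ (identity q x m) (·-suc-⊕ q xs ms)
  where
  identity : ∀ q a b → (q Z.* a Z.+ b) Z.+ a ≡ (1ℤ Z.+ q) Z.* a Z.+ b
  identity = solve-∀

·-suc-⊖ : (q : ℤ) (x μ : Lat n) → ((Z.suc q · x) ⊕ μ) ⊖ x ≡ (q · x) ⊕ μ
·-suc-⊖ q [] [] = refl
·-suc-⊖ q (x ∷ xs) (m ∷ ms) = cong₂ _∷_ (identity q x m) (·-suc-⊖ q xs ms)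
  where
  identity : ∀ q a b → ((1ℤ Z.+ q) Z.* a Z.+ b) Z.+ (Z.- 1ℤ) Z.* a ≡ q Z.* a Z.+ b
  identity = solve-∀

t-∙ : (λ′ μ : Lat n) (M : Mat n) → t λ′ ∙ (μ , M) ≡ (λ′ ⊕ μ , M)
t-∙ λ′ μ M = cong₂ _,_ (cong (λ′ ⊕_) (idM-⋆ μ)) (idM-∘M M)

t-zero-∙ : (w : Aff n) → t zeroL ∙ w ≡ w
t-zero-∙ (μ , M) = trans (t-∙ zeroL μ M) (cong (_, M) (⊕-identityˡ μ))

IsTranslation : Aff n → Set
IsTranslation g = proj₂ g ≡ idM

∙-isTranslation : {g h : Aff n} → IsTranslation g → IsTranslation h → IsTranslation (g ∙ h)
∙-isTranslation g-t h-t = trans (cong₂ _∘M_ g-t h-t) (idM-∘M idM)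

translations-commute : (λ′ : Lat n) {h : Aff n} → IsTranslation h → (w : Aff n) →
                       (t λ′ ∙ h) ∙ w ≡ h ∙ (t λ′ ∙ w)
translations-commute λ′ {μ , _} refl (ν , M) = begin
  (t λ′ ∙ t μ) ∙ (ν , M)   ≡⟨ cong (_∙ (ν , M)) (t-∙ λ′ μ idM) ⟩
  t (λ′ ⊕ μ) ∙ (ν , M)     ≡⟨ t-∙ (λ′ ⊕ μ) ν M ⟩
  ((λ′ ⊕ μ) ⊕ ν , M)       ≡⟨ cong (_, M) (⊕-assoc-comm λ′ μ ν) ⟩
  (μ ⊕ (λ′ ⊕ ν) , M)       ≡⟨ t-∙ μ (λ′ ⊕ ν) M ⟨
  t μ ∙ (λ′ ⊕ ν , M)       ≡⟨ cong (t μ ∙_) (t-∙ λ′ ν M) ⟨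
  t μ ∙ (t λ′ ∙ (ν , M))   ∎
  where open ≡-Reasoning

t-∙-t-· : (q : ℤ) (x : Lat n) (w : Aff n) → t x ∙ (t (q · x) ∙ w) ≡ t (Z.suc q · x) ∙ w
t-∙-t-· q x (ν , M) = begin
  t x ∙ (t (q · x) ∙ (ν , M))   ≡⟨ cong (t x ∙_) (t-∙ (q · x) ν M) ⟩
  t x ∙ ((q · x) ⊕ ν , M)       ≡⟨ t-∙ x ((q · x) ⊕ ν) M ⟩
  (x ⊕ ((q · x) ⊕ ν) , M)       ≡⟨ cong (_, M) (⊕-·-suc q x ν) ⟩
  ((Z.suc q · x) ⊕ ν , M)       ≡⟨ t-∙ (Z.suc q · x) ν M ⟨
  t (Z.suc q · x) ∙ (ν , M)     ∎
  where open ≡-Reasoning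

ℤ-induction : ∀ {ℓ} (P : ℤ → Set ℓ) → P 0ℤ →
              (∀ q → P q → P (Z.suc q)) → (∀ q → P (Z.suc q) → P q) → ∀ q → P q
ℤ-induction P P0 up down (+ k) = nonneg k
  where
  nonneg : ∀ k → P (+ k)
  nonneg zero = P0
  nonneg (suc k) = up (+ k) (nonneg k)
ℤ-induction P P0 up down -[1+ k ] = neg k
  where
  neg : ∀ k → P -[1+ k ]
  neg zero = down -[1+ 0 ] P0
  neg (suc k) = down -[1+ suc k ] (neg k)

module _ (R : RootDatum n) {a a∨ : Lat n} (a∈Φ : (a , a∨) ∈ Φ R) where

  InQ∨-shift : {μ : Lat n} → InQ∨ R μ → (q : ℤ) → InQ∨ R ((q · a∨) ⊕ μ)
  InQ∨-shift {μ} μ∈Q∨ = ℤ-induction (λ q → InQ∨ R ((q · a∨) ⊕ μ)) base up down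
    where
    base : InQ∨ R ((0ℤ · a∨) ⊕ μ)
    base = subst (InQ∨ R) (sym (trans (cong (_⊕ μ) (·-zeroˡ a∨)) (⊕-identityˡ μ))) μ∈Q∨
    up : ∀ q → InQ∨ R ((q · a∨) ⊕ μ) → InQ∨ R ((Z.suc q · a∨) ⊕ μ)
    up q = subst (InQ∨ R) (·-suc-⊕ q a∨ μ) ∘ q-plus a∈Φ
    down : ∀ q → InQ∨ R ((Z.suc q · a∨) ⊕ μ) → InQ∨ R ((q · a∨) ⊕ μ)
    down q = subst (InQ∨ R) (·-suc-⊖ q a∨ μ) ∘ q-minus a∈Φ

  InWaf-shift : (q : ℤ) {w : Aff n} → InWaf R w → InWaf R (t (q · a∨) ∙ w)
  InWaf-shift q {μ , M} (μ∈Q∨ , M∈W) =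
    subst (InWaf R) (sym (t-∙ (q · a∨) μ M)) (InQ∨-shift μ∈Q∨ q , M∈W)

Translations : ZAff n → Set
Translations = All (IsTranslation ∘ proj₂)

*Z-translations : {X Y : ZAff n} → Translations X → Translations Y → Translations (X *Z Y)
*Z-translations [] Y-t = []
*Z-translations {X = (c , g) ∷ _} (g-t ∷ X-t) Y-t =
  AllP.++⁺ (AllP.map⁺ (All.map (λ {y} → ∙-isTranslation {g = g} {proj₂ y} g-t) Y-t))
           (*Z-translations X-t Y-t)

Δ : Lat n → ZAff n
Δ a∨ = oneZ -Z [ t a∨ ]

Δ^Z-translations : (a∨ : Lat n) (k : ℕ) → Translations (Δ a∨ ^Z k)
Δ^Z-translations a∨ zero = refl ∷ []
Δ^Z-translations a∨ (suc k) = *Z-translations {X = Δ a∨} (refl ∷ refl ∷ []) (Δ^Z-translations a∨ k)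

∷-*Z : (x : ℤ × Aff n) (Z X : ZAff n) → (x ∷ Z) *Z X ≡ ((x ∷ []) *Z X) ++ (Z *Z X)
∷-*Z (c , g) Z X = cong (_++ (Z *Z X)) (sym (LP.++-identityʳ _))

linExt-++ : (F : Aff n → Poly n) (X Y : ZAff n) → linExt F (X ++ Y) ≈P (linExt F X ⊞ linExt F Y)
linExt-++ F [] Y v = sym (ZP.+-identityˡ _)
linExt-++ F ((c , g) ∷ X) Y v =
  trans (cong (Z._+_ (c Z.* eval (F g) v)) (linExt-++ F X Y v))
        (sym (ZP.+-assoc (c Z.* eval (F g) v) (eval (linExt F X) v) (eval (linExt F Y) v)))

linExt-*Z-[] : (F : Aff n → Poly n) (X : ZAff n) (w : Aff n) →
               linExt F (X *Z [ w ]) ≈P linExt (λ h → F (h ∙ w)) X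
linExt-*Z-[] F [] w v = refl
linExt-*Z-[] F ((c , g) ∷ X) w v =
  cong₂ (λ c′ r → c′ Z.* eval (F (g ∙ w)) v Z.+ r) (ZP.*-identityʳ c) (linExt-*Z-[] F X w v)

linExt-[]*Z : (F : Aff n → Poly n) (c : ℤ) (g : Aff n) (X : ZAff n) →
              linExt F (((c , g) ∷ []) *Z X) ≈P (con c ⊠ linExt (λ h → F (g ∙ h)) X)
linExt-[]*Z F c g [] v = sym (ZP.*-zeroʳ c)
linExt-[]*Z F c g ((e , h) ∷ X) v =
  trans (cong (Z._+_ ((c Z.* e) Z.* eval (F (g ∙ h)) v)) (linExt-[]*Z F c g X v))
        (distrib c e (eval (F (g ∙ h)) v) _)
  where
  distrib : ∀ c e x r → (c Z.* e) Z.* x Z.+ c Z.* r ≡ c Z.* (e Z.* x Z.+ r)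
  distrib = solve-∀

linExt-cong : (F G : Aff n → Poly n) {X : ZAff n} → Translations X →
              (∀ h → IsTranslation h → F h ≈P G h) → linExt F X ≈P linExt G X
linExt-cong F G [] F≈G v = refl
linExt-cong F G {(c , h) ∷ _} (h-t ∷ X-t) F≈G v =
  cong₂ (λ x r → c Z.* x Z.+ r) (F≈G h h-t v) (linExt-cong F G X-t F≈G v)

linExt-Δ-*Z : (f : Aff n → Poly n) (a∨ : Lat n) {X : ZAff n} → Translations X → (w : Aff n) →
              linExt f ((Δ a∨ *Z X) *Z [ w ]) ≈P
              (linExt f (X *Z [ w ]) ⊞ (⊟ linExt f (X *Z [ t a∨ ∙ w ])))
linExt-Δ-*Z f a∨ {X} X-t w v = begin
  eval (linExt f ((Δ a∨ *Z X) *Z [ w ])) v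
    ≡⟨ linExt-*Z-[] f (Δ a∨ *Z X) w v ⟩
  eval (linExt F (Δ a∨ *Z X)) v
    ≡⟨ cong (λ Y → eval (linExt F Y) v) (∷-*Z (1ℤ , t zeroL) ((Z.- 1ℤ , t a∨) ∷ []) X) ⟩
  eval (linExt F (Y₀ ++ Y₁)) v
    ≡⟨ linExt-++ F Y₀ Y₁ v ⟩
  eval (linExt F Y₀) v Z.+ eval (linExt F Y₁) v
    ≡⟨ cong₂ Z._+_ (linExt-[]*Z F 1ℤ (t zeroL) X v) (linExt-[]*Z F (Z.- 1ℤ) (t a∨) X v) ⟩
  1ℤ Z.* eval (linExt (λ h → F (t zeroL ∙ h)) X) v
    Z.+ (Z.- 1ℤ) Z.* eval (linExt (λ h → F (t a∨ ∙ h)) X) v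
    ≡⟨ cong₂ (λ x y → 1ℤ Z.* x Z.+ (Z.- 1ℤ) Z.* y)
         (linExt-cong _ _ X-t (λ h h-t u → cong (λ g → eval (f g) u)
           (trans (translations-commute zeroL h-t w) (cong (h ∙_) (t-zero-∙ w)))) v)
         (linExt-cong _ _ X-t (λ h h-t u → cong (λ g → eval (f g) u)
           (translations-commute a∨ h-t w)) v) ⟩
  1ℤ Z.* eval (linExt F X) v Z.+ (Z.- 1ℤ) Z.* eval (linExt F′ X) v
    ≡⟨ difference (eval (linExt F X) v) (eval (linExt F′ X) v) ⟩
  eval (linExt F X) v Z.- eval (linExt F′ X) v
    ≡⟨ cong₂ Z._-_ (linExt-*Z-[] f X w v) (linExt-*Z-[] f X (t a∨ ∙ w) v) ⟨
  eval (linExt f (X *Z [ w ])) v Z.- eval (linExt f (X *Z [ t a∨ ∙ w ])) v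
    ∎
  where
  open ≡-Reasoning
  F F′ : Aff _ → Poly _
  F h = f (h ∙ w)
  F′ h = f (h ∙ (t a∨ ∙ w))
  Y₀ Y₁ : ZAff _
  Y₀ = ((1ℤ , t zeroL) ∷ []) *Z X
  Y₁ = ((Z.- 1ℤ , t a∨) ∷ []) *Z X
  difference : ∀ x y → 1ℤ Z.* x Z.+ (Z.- 1ℤ) Z.* y ≡ x Z.- y
  difference = solve-∀

infix 4 _≡_mod_

_≡_mod_ : Poly n → Poly n → Poly n → Set
P ≡ Q mod A = A ∣P (P ⊞ (⊟ Q))

∣P-resp-≈P : {A P Q : Poly n} → P ≈P Q → A ∣P P → A ∣P Q
∣P-resp-≈P P≈Q (h , P≈Ah) = h , λ v → trans (sym (P≈Q v)) (P≈Ah v)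

mod-refl : (A P : Poly n) → P ≡ P mod A
mod-refl A P = con 0ℤ , λ v → trans (ZP.+-inverseʳ (eval P v)) (sym (ZP.*-zeroʳ (eval A v)))

mod-sym : {A P Q : Poly n} → P ≡ Q mod A → Q ≡ P mod A
mod-sym {A = A} {P} {Q} (h , P-Q≈Ah) = ⊟ h , λ v → begin
  eval Q v Z.- eval P v          ≡⟨ negate-difference (eval P v) (eval Q v) ⟩
  Z.- (eval P v Z.- eval Q v)    ≡⟨ cong Z.-_ (P-Q≈Ah v) ⟩
  Z.- (eval A v Z.* eval h v)    ≡⟨ ZP.neg-distribʳ-* (eval A v) (eval h v) ⟩
  eval A v Z.* Z.- eval h v      ∎
  where
  open ≡-Reasoning
  negate-difference : ∀ p q → q Z.- p ≡ Z.- (p Z.- q)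
  negate-difference = solve-∀

mod-trans : {A P Q R : Poly n} → P ≡ Q mod A → Q ≡ R mod A → P ≡ R mod A
mod-trans {A = A} {P} {Q} {R} (h , P-Q≈Ah) (h′ , Q-R≈Ah′) = h ⊞ h′ , λ v → begin
  eval P v Z.- eval R v                                   ≡⟨ split (eval P v) (eval Q v) (eval R v) ⟩
  (eval P v Z.- eval Q v) Z.+ (eval Q v Z.- eval R v)     ≡⟨ cong₂ Z._+_ (P-Q≈Ah v) (Q-R≈Ah′ v) ⟩
  eval A v Z.* eval h v Z.+ eval A v Z.* eval h′ v
    ≡⟨ ZP.*-distribˡ-+ (eval A v) (eval h v) (eval h′ v) ⟨
  eval A v Z.* (eval h v Z.+ eval h′ v)                   ∎
  where
  open ≡-Reasoning
  split : ∀ p q r → p Z.- r ≡ (p Z.- q) Z.+ (q Z.- r)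
  split = solve-∀

telescope : (A : Poly n) (E : ℤ → Poly n) → (∀ q → E q ≡ E (Z.suc q) mod A) →
            ∀ q → E 0ℤ ≡ E q mod A
telescope A E step = ℤ-induction (λ q → E 0ℤ ≡ E q mod A) (mod-refl A (E 0ℤ))
  (λ q E₀≡Eq → mod-trans {A = A} {E 0ℤ} {E q} {E (Z.suc q)} E₀≡Eq (step q))
  (λ q E₀≡Esq → mod-trans {A = A} {E 0ℤ} {E (Z.suc q)} {E q} E₀≡Esq
                  (mod-sym {A = A} {E q} {E (Z.suc q)} (step q)))

lemma4p1 : ∀ {n} (R : RootDatum n) (f : Aff n → Poly n) →
    (∀ (d : ℕ) → 1 ≤ d → ∀ (w : Aff n) → InWaf R w → ∀ {a a∨} → (a , a∨) ∈ Φ R →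
       (lin a ^P d) ∣P linExt f (((oneZ -Z [ t a∨ ]) ^Z d) *Z [ w ])) →
    ∀ (d : ℕ) → 1 ≤ d → (p : ℤ) → ∀ {a a∨} → (a , a∨) ∈ Φ R →
    ∀ (w : Aff n) → InWaf R w →
      (lin a ^P d) ∣P
        (linExt f (((oneZ -Z [ t a∨ ]) ^Z (d ∸ 1)) *Z [ w ])
         ⊞ (⊟ linExt f (((oneZ -Z [ t a∨ ]) ^Z (d ∸ 1)) *Z [ t (p · a∨) ∙ w ])))
lemma4p1 {n} R f hyp (suc k) _ p {a} {a∨} a∈Φ w w∈Waf =
  subst (λ u → g u ≡ g (t (p · a∨) ∙ w) mod A) t₀w≡w (telescope A (g ∘ shift) consecutive p)
  where
  A : Poly n
  A = lin a ^P suc k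
  g : Aff n → Poly n
  g u = linExt f ((Δ a∨ ^Z k) *Z [ u ])
  shift : ℤ → Aff n
  shift q = t (q · a∨) ∙ w
  t₀w≡w : shift 0ℤ ≡ w
  t₀w≡w = trans (cong (λ x → t x ∙ w) (·-zeroˡ a∨)) (t-zero-∙ w)
  g≡g-t∙ : ∀ u → InWaf R u → g u ≡ g (t a∨ ∙ u) mod A
  g≡g-t∙ u u∈Waf =
    ∣P-resp-≈P {A = A} {linExt f ((Δ a∨ *Z (Δ a∨ ^Z k)) *Z [ u ])} {g u ⊞ (⊟ g (t a∨ ∙ u))}
      (linExt-Δ-*Z f a∨ (Δ^Z-translations a∨ k) u) (hyp (suc k) (s≤s z≤n) u u∈Waf a∈Φ)
  consecutive : ∀ q → g (shift q) ≡ g (shift (Z.suc q)) mod A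
  consecutive q = subst (λ u → g (shift q) ≡ g u mod A) (t-∙-t-· q a∨ w)
                        (g≡g-t∙ (shift q) (InWaf-shift R a∈Φ q w∈Waf))
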